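{- Let $m \geq 1$, let $p_1, p_2, \ldots, p_m$ be distinct primes and $n = p_1 p_2 \cdots p_m$. Then the non-nilradical graph $\Omega(\mathbb{Z}_n)$ is a very cost effective graph.
   Context: $\mathbb{Z}_n$ is the ring of residue classes modulo $n$. The non-nilradical graph $\Omega(\mathbb{Z}_n)$ has as vertices the non-nilpotent (nonzero) zero-divisors of $\mathbb{Z}_n$, two distinct vertices $x,y$ being adjacent iff $xy=0$. For a graph $G=(V,E)$, $N(v)$ denotes the open neighborhood of $v$. Given $S \subseteq V$, a vertex $v \in S$ is very cost effective if $|N(v)\cap S| < |N(v) \cap (V\setminus S)|$; a set $S$ is very cost effective if every vertex of $S$ is very cost effective. A bipartition $\{S, V\setminus S\}$ is very cost effective if both parts are very cost effective sets, and $G$ is a very cost effective graph if it has a very cost effective bipartition. -}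

module Defs where

open import Data.Nat using (ℕ; zero; suc; _*_; _^_; _<_)
open import Data.Nat.Divisibility using (_∣_)
open import Data.Fin using (Fin; toℕ)
open import Data.Bool using (Bool; true; false)
open import Data.Product using (Σ; ∃; _×_)
open import Function.Definitions using (Injective)
open import Relation.Binary.PropositionalEquality using (_≡_; _≢_)
open import Relation.Nullary using (¬_)

-- Elements of ℤ_n are represented by Fin n (residues 0 … n-1).
-- Multiplication xy = 0 in ℤ_n  ⇔  n ∣ x*y.
IsZero : ∀ {n} → Fin n → Set
IsZero x = toℕ x ≡ 0

ZeroDivisor : (n : ℕ) → Fin n → Set
ZeroDivisor n x = (¬ IsZero x) × Σ (Fin n) (λ y → (¬ IsZero y) × (n ∣ toℕ x * toℕ y))

Nilpotent : (n : ℕ) → Fin n → Set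
Nilpotent n x = Σ ℕ (λ k → n ∣ toℕ x ^ suc k)

Vertex : (n : ℕ) → Fin n → Set
Vertex n x = ZeroDivisor n x × (¬ Nilpotent n x)

Adj : (n : ℕ) → Fin n → Fin n → Set
Adj n x y = Vertex n x × Vertex n y × (x ≢ y) × (n ∣ toℕ x * toℕ y)

HasCard : ∀ {n} → (Fin n → Set) → ℕ → Set
HasCard {n} P k =
  Σ (Fin k → Fin n) λ f →
    Injective _≡_ _≡_ f × (∀ i → P (f i)) × (∀ x → P x → ∃ λ i → f i ≡ x)

-- Bipartition {S, V∖S} of the vertex set, S given by a Boolean labelling:
-- S = {v ∈ V | s v ≡ true},  V∖S = {v ∈ V | s v ≡ false}.
InPart : (n : ℕ) → (Fin n → Bool) → Bool → Fin n → Set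
InPart n s b x = Vertex n x × (s x ≡ b)

VeryCostEffectiveVertex : (n : ℕ) → (Fin n → Bool) → Bool → Fin n → Set
VeryCostEffectiveVertex n s b v =
  Σ ℕ λ a → Σ ℕ λ c →
    HasCard (λ u → Adj n v u × InPart n s b u) a ×
    HasCard (λ u → Adj n v u × ¬ InPart n s b u) c ×
    (a < c)

VeryCostEffectiveSet : (n : ℕ) → (Fin n → Bool) → Bool → Set
VeryCostEffectiveSet n s b = ∀ v → InPart n s b v → VeryCostEffectiveVertex n s b v

VeryCostEffectiveGraph : ℕ → Set
VeryCostEffectiveGraph n =
  Σ (Fin n → Bool) λ s → VeryCostEffectiveSet n s true × VeryCostEffectiveSet n s false

module Submission where

-- Write n = p * R with p = p₁ prime, p ∤ R, and let S be the set of vertices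
-- NOT divisible by p (labelled true); V∖S consists of the vertices divisible
-- by p (labelled false).
--  * v ∈ S: if vu ≡ 0 (mod n) then p ∣ vu and p ∤ v, so p ∣ u; hence v has
--    no neighbour in S, while it has at least one neighbour (it is a zero
--    divisor), which then lies in V∖S.
--  * v ∈ V∖S: since p ∣ v we have n ∣ vR, so the shift u ↦ u + R (mod n)
--    maps neighbours of v in V∖S injectively to neighbours of v in S
--    (p ∤ u + R), and the image of 0 under the shift is a further neighbour
--    in S that is not hit.
-- Because n is squarefree, n ∣ x^(k+1) forces x ≡ 0, so every nonzero zero
-- divisor is a vertex.

open import Defs
open import Data.Nat using (ℕ; zero; suc; _+_; _*_; _∸_; _^_; _≤_; _<_; NonZero; _%_)
open import Data.Nat.Base using (≢-nonZero; >-nonZero⁻¹)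
open import Data.Nat.Properties
  using (_≟_; *-comm; *-zeroʳ; *-distribˡ-+; +-assoc; m+[n∸m]≡n; m≤m*n; m*n≢0; <⇒≱)
open import Data.Nat.Divisibility
open import Data.Nat.DivMod
open import Data.Nat.Primality using (Prime; euclidsLemma; ¬prime[1]; prime⇒irreducible; prime⇒nonZero)
open import Data.List using (List; []; _∷_; length)
open import Data.Nat.ListAction using (product)
open import Data.List.Relation.Unary.All using (All; []; _∷_)
open import Data.List.Relation.Unary.AllPairs using (_∷_)
open import Data.List.Relation.Unary.Unique.Propositional using (Unique)
open import Data.Fin using (Fin; zero; suc; toℕ; fromℕ<)
open import Data.Fin.Properties using (toℕ-injective; toℕ<n; toℕ-fromℕ<; injective⇒≤; suc-injective; any?)
import Data.Fin.Properties as Fin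
open import Data.Bool using (Bool; true; false)
import Data.Bool.Properties as Bool
open import Data.Product using (Σ; ∃; _×_; _,_; proj₁; proj₂)
open import Data.Sum using (inj₁; inj₂)
open import Data.Empty using (⊥-elim)
open import Function.Definitions using (Injective)
open import Relation.Nullary using (¬_; yes; no)
open import Relation.Nullary.Decidable using (map′; ¬?; _×-dec_)
open import Relation.Unary using (Decidable)
open import Relation.Binary.PropositionalEquality

-- Counting in Fin n

card-with-zero : ∀ {n} {P : Fin (suc n) → Set} → P zero →
                 Σ ℕ (HasCard (λ x → P (suc x))) → Σ ℕ (HasCard P)
card-with-zero {n} {P} pz (k , f , f-inj , f-in , f-onto) = suc k , g , g-inj , g-in , g-onto
  where
  g : Fin (suc k) → Fin (suc n)
  g zero    = zero
  g (suc i) = suc (f i)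
  g-inj : Injective _≡_ _≡_ g
  g-inj {zero}  {zero}  _ = refl
  g-inj {suc i} {suc j} e = cong suc (f-inj (suc-injective e))
  g-in : ∀ i → P (g i)
  g-in zero    = pz
  g-in (suc i) = f-in i
  g-onto : ∀ x → P x → ∃ λ i → g i ≡ x
  g-onto zero    _  = zero , refl
  g-onto (suc x) px = let (i , e) = f-onto x px in suc i , cong suc e

card-without-zero : ∀ {n} {P : Fin (suc n) → Set} → ¬ P zero →
                    Σ ℕ (HasCard (λ x → P (suc x))) → Σ ℕ (HasCard P)
card-without-zero {n} {P} ¬pz (k , f , f-inj , f-in , f-onto) =
  k , (λ i → suc (f i)) , (λ e → f-inj (suc-injective e)) , f-in , g-onto
  where
  g-onto : ∀ x → P x → ∃ λ i → suc (f i) ≡ x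
  g-onto zero    pz = ⊥-elim (¬pz pz)
  g-onto (suc x) px = let (i , e) = f-onto x px in i , cong suc e

count : ∀ {n} (P : Fin n → Set) → Decidable P → Σ ℕ (HasCard P)
count {zero}  P P? = 0 , (λ ()) , (λ {}) , (λ ()) , (λ ())
count {suc n} P P? with P? zero
... | yes pz = card-with-zero  {P = P} pz  (count (λ x → P (suc x)) (λ x → P? (suc x)))
... | no ¬pz = card-without-zero {P = P} ¬pz (count (λ x → P (suc x)) (λ x → P? (suc x)))

-- An injection sending P into Q whose image on P avoids some z ∈ Q
-- shows |P| < |Q|: together with z it embeds Fin (1 + |P|) into Fin |Q|.
card-< : ∀ {n} {P Q : Fin n → Set} {a c} → HasCard P a → HasCard Q c →
         (f : Fin n → Fin n) → Injective _≡_ _≡_ f → (∀ x → P x → Q (f x)) →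
         (z : Fin n) → Q z → (∀ x → P x → f x ≢ z) → a < c
card-< {Q = Q} {a = a} {c} (eP , eP-inj , eP-in , _) (eQ , _ , _ , eQ-onto) f f-inj f-maps z qz misses =
  injective⇒≤ g-inj
  where
  index : ∀ x → Q x → Fin c
  index x qx = proj₁ (eQ-onto x qx)
  index-inj : ∀ {x y} qx qy → index x qx ≡ index y qy → x ≡ y
  index-inj qx qy e = trans (sym (proj₂ (eQ-onto _ qx))) (trans (cong eQ e) (proj₂ (eQ-onto _ qy)))
  g : Fin (suc a) → Fin c
  g zero    = index z qz
  g (suc i) = index (f (eP i)) (f-maps _ (eP-in i))
  g-inj : Injective _≡_ _≡_ g
  g-inj {zero}  {zero}  _ = refl
  g-inj {zero}  {suc j} e = ⊥-elim (misses _ (eP-in j) (sym (index-inj qz _ e)))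
  g-inj {suc i} {zero}  e = ⊥-elim (misses _ (eP-in i) (index-inj _ qz e))
  g-inj {suc i} {suc j} e = cong suc (eP-inj (f-inj (index-inj _ _ e)))

card-empty-< : ∀ {n} {P Q : Fin n → Set} {a c} → HasCard P a → HasCard Q c →
               (∀ x → ¬ P x) → (z : Fin n) → Q z → a < c
card-empty-< cP cQ empty z qz =
  card-< cP cQ (λ x → x) (λ e → e) (λ x px → ⊥-elim (empty x px)) z qz (λ x px → ⊥-elim (empty x px))

-- Arithmetic of products of distinct primes

prime∤1 : ∀ {p} → Prime p → ¬ p ∣ 1
prime∤1 pp p∣1 = ¬prime[1] (subst Prime (∣1⇒≡1 p∣1) pp)

prime∣power⇒∣base : ∀ {p} x k → Prime p → p ∣ x ^ suc k → p ∣ x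
prime∣power⇒∣base x zero pp p∣x¹ with euclidsLemma x 1 pp p∣x¹
... | inj₁ p∣x = p∣x
... | inj₂ p∣1 = ⊥-elim (prime∤1 pp p∣1)
prime∣power⇒∣base x (suc k) pp p∣xᵏ⁺² with euclidsLemma x (x ^ suc k) pp p∣xᵏ⁺²
... | inj₁ p∣x   = p∣x
... | inj₂ p∣xᵏ⁺¹ = prime∣power⇒∣base x k pp p∣xᵏ⁺¹

prime∤product : ∀ {p} qs → Prime p → All Prime qs → All (λ q → p ≢ q) qs → ¬ p ∣ product qs
prime∤product []       pp _           _           p∣1 = prime∤1 pp p∣1
prime∤product (q ∷ qs) pp (pq ∷ pqs) (p≢q ∷ p≢qs) p∣q*qs with euclidsLemma q (product qs) pp p∣q*qs
... | inj₂ p∣qs = prime∤product qs pp pqs p≢qs p∣qs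
... | inj₁ p∣q with prime⇒irreducible pq p∣q
...   | inj₁ p≡1 = ¬prime[1] (subst Prime p≡1 pp)
...   | inj₂ p≡q = p≢q p≡q

prime*coprime∣ : ∀ {q R x} → Prime q → ¬ q ∣ R → q ∣ x → R ∣ x → q * R ∣ x
prime*coprime∣ {q} {R} pq q∤R q∣x (divides c refl) with euclidsLemma c R pq q∣x
... | inj₁ q∣c = *-monoˡ-∣ R q∣c
... | inj₂ q∣R = ⊥-elim (q∤R q∣R)

product-squarefree : ∀ ps → All Prime ps → Unique ps →
                     ∀ x k → product ps ∣ x ^ suc k → product ps ∣ x
product-squarefree []       _           _          x k _ = 1∣ x
product-squarefree (q ∷ qs) (pq ∷ pqs) (q∉qs ∷ uq) x k ps∣xᵏ⁺¹ =
  prime*coprime∣ pq (prime∤product qs pq pqs q∉qs)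
    (prime∣power⇒∣base x k pq (m*n∣⇒m∣ q (product qs) ps∣xᵏ⁺¹))
    (product-squarefree qs pqs uq x k (m*n∣⇒n∣ q (product qs) ps∣xᵏ⁺¹))

-- Modular arithmetic

∣*-mod : ∀ w a d .{{_ : NonZero d}} → d ∣ w * a → d ∣ w * (a % d)
∣*-mod w a d d∣wa = m%n≡0⇒n∣m _ d (begin
    w * (a % d) % d                  ≡⟨ %-distribˡ-* w (a % d) d ⟩
    (w % d) * (a % d % d) % d        ≡⟨ cong (λ t → (w % d) * t % d) (m%n%n≡m%n a d) ⟩
    (w % d) * (a % d) % d            ≡⟨ %-distribˡ-* w a d ⟨
    w * a % d                        ≡⟨ n∣m⇒m%n≡0 _ d d∣wa ⟩
    0                                ∎)
  where open ≡-Reasoning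

+-mod-inverse : ∀ a R d .{{_ : NonZero d}} → a < d → R ≤ d → ((a + R) % d + (d ∸ R)) % d ≡ a
+-mod-inverse a R d a<d R≤d = begin
    ((a + R) % d + (d ∸ R)) % d        ≡⟨ %-distribˡ-+ ((a + R) % d) (d ∸ R) d ⟩
    ((a + R) % d % d + (d ∸ R) % d) % d ≡⟨ cong (λ t → (t + (d ∸ R) % d) % d) (m%n%n≡m%n (a + R) d) ⟩
    ((a + R) % d + (d ∸ R) % d) % d     ≡⟨ %-distribˡ-+ (a + R) (d ∸ R) d ⟨
    (a + R + (d ∸ R)) % d               ≡⟨ cong (_% d) (+-assoc a R (d ∸ R)) ⟩
    (a + (R + (d ∸ R))) % d             ≡⟨ cong (λ t → (a + t) % d) (m+[n∸m]≡n R≤d) ⟩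
    (a + d) % d                         ≡⟨ [m+n]%n≡m%n a d ⟩
    a % d                               ≡⟨ m<n⇒m%n≡m a<d ⟩
    a                                   ∎
  where open ≡-Reasoning

module Bipartition (p R : ℕ) (p-prime : Prime p) (p∤R : ¬ p ∣ R)
                   (squarefree : ∀ x k → p * R ∣ x ^ suc k → p * R ∣ x) where

  n : ℕ
  n = p * R

  -- R ≢ 0 because p ∤ R; hence n ≢ 0, so Fin n is inhabited and _% n is defined.
  instance
    R≢0 : NonZero R
    R≢0 = ≢-nonZero (λ R≡0 → p∤R (subst (p ∣_) (sym R≡0) (p ∣0)))
    p≢0 : NonZero p
    p≢0 = prime⇒nonZero p-prime
    n≢0 : NonZero n
    n≢0 = m*n≢0 p R

  p∣n : p ∣ n
  p∣n = m∣m*n R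

  multiple⇒zero : (x : Fin n) → n ∣ toℕ x → IsZero x
  multiple⇒zero x n∣x with toℕ x | toℕ<n x
  ... | zero  | _   = refl
  ... | suc m | x<n = ⊥-elim (<⇒≱ x<n (∣⇒≤ n∣x))

  -- Since n is squarefree, ℤ_n has no nonzero nilpotents.
  nonzero⇒non-nilpotent : ∀ x → ¬ IsZero x → ¬ Nilpotent n x
  nonzero⇒non-nilpotent x x≢0 (k , n∣xᵏ⁺¹) = x≢0 (multiple⇒zero x (squarefree _ k n∣xᵏ⁺¹))

  annihilator-vertex : ∀ {v u} → Vertex n v → ¬ IsZero u → n ∣ toℕ v * toℕ u → Vertex n u
  annihilator-vertex {v} {u} ((v≢0 , _) , _) u≢0 n∣vu =
    (u≢0 , v , v≢0 , subst (n ∣_) (*-comm (toℕ v) (toℕ u)) n∣vu) , nonzero⇒non-nilpotent u u≢0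

  vertex? : Decidable (Vertex n)
  vertex? x = map′ (λ zd → zd , nonzero⇒non-nilpotent x (proj₁ zd)) proj₁
    (¬? (toℕ x ≟ 0) ×-dec any? (λ y → ¬? (toℕ y ≟ 0) ×-dec (n ∣? toℕ x * toℕ y)))

  adjacent? : ∀ v → Decidable (Adj n v)
  adjacent? v u = vertex? v ×-dec vertex? u ×-dec ¬? (v Fin.≟ u) ×-dec (n ∣? toℕ v * toℕ u)

  label : Fin n → Bool
  label x with p ∣? toℕ x
  ... | yes _ = false
  ... | no  _ = true

  label-true : ∀ x → label x ≡ true → ¬ p ∣ toℕ x
  label-true x _  with p ∣? toℕ x
  label-true x () | yes _
  label-true x _  | no p∤x = p∤x

  label-false : ∀ x → label x ≡ false → p ∣ toℕ x
  label-false x _  with p ∣? toℕ x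
  label-false x _  | yes p∣x = p∣x
  label-false x () | no _

  SameSide OtherSide : Bool → Fin n → Fin n → Set
  SameSide  b v u = Adj n v u × InPart n label b u
  OtherSide b v u = Adj n v u × ¬ InPart n label b u

  very-cost-effective : ∀ b v →
    (∀ {a c} → HasCard (SameSide b v) a → HasCard (OtherSide b v) c → a < c) →
    VeryCostEffectiveVertex n label b v
  very-cost-effective b v compare
    with count (SameSide b v)  (λ u → adjacent? v u ×-dec inPart? u)
       | count (OtherSide b v) (λ u → adjacent? v u ×-dec ¬? (inPart? u))
    where
    inPart? : Decidable (InPart n label b)
    inPart? u = vertex? u ×-dec (label u Bool.≟ b)
  ... | a , same | c , other = a , c , same , other , compare same other

  -- A vertex v with p ∤ v has no neighbour in S, and its annihilating
  -- witness is a neighbour outside S.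
  S-very-cost-effective : VeryCostEffectiveSet n label true
  S-very-cost-effective v (v-vertex@((_ , y , y≢0 , n∣vy) , _) , v∈S) =
    very-cost-effective true v λ same other →
      card-empty-< same other no-same-neighbour y y-other-side
    where
    p∤v : ¬ p ∣ toℕ v
    p∤v = label-true v v∈S
    -- p divides vu and not v, hence every neighbour u
    neighbour-divisible : ∀ u → n ∣ toℕ v * toℕ u → p ∣ toℕ u
    neighbour-divisible u n∣vu with euclidsLemma (toℕ v) (toℕ u) p-prime (∣-trans p∣n n∣vu)
    ... | inj₁ p∣v = ⊥-elim (p∤v p∣v)
    ... | inj₂ p∣u = p∣u
    no-same-neighbour : ∀ u → ¬ SameSide true v u
    no-same-neighbour u ((_ , _ , _ , n∣vu) , (_ , u∈S)) = label-true u u∈S (neighbour-divisible u n∣vu)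
    p∣y : p ∣ toℕ y
    p∣y = neighbour-divisible y n∣vy
    y-other-side : OtherSide true v y
    y-other-side =
      (v-vertex , annihilator-vertex v-vertex y≢0 n∣vy , (λ v≡y → p∤v (subst (λ t → p ∣ toℕ t) (sym v≡y) p∣y)) , n∣vy)
      , λ y∈S → label-true y (proj₂ y∈S) p∣y

  shift : Fin n → Fin n
  shift u = fromℕ< (m%n<n (toℕ u + R) n)

  toℕ-shift : ∀ u → toℕ (shift u) ≡ (toℕ u + R) % n
  toℕ-shift u = toℕ-fromℕ< (m%n<n (toℕ u + R) n)

  shift-injective : Injective _≡_ _≡_ shift
  shift-injective {x} {y} e = toℕ-injective (begin
      toℕ x                               ≡⟨ +-mod-inverse (toℕ x) R n (toℕ<n x) R≤n ⟨
      ((toℕ x + R) % n + (n ∸ R)) % n     ≡⟨ cong (λ t → (t + (n ∸ R)) % n) shifts-equal ⟩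
      ((toℕ y + R) % n + (n ∸ R)) % n     ≡⟨ +-mod-inverse (toℕ y) R n (toℕ<n y) R≤n ⟩
      toℕ y                               ∎)
    where
    open ≡-Reasoning
    R≤n : R ≤ n
    R≤n = subst (R ≤_) (*-comm R p) (m≤m*n R p)
    shifts-equal : (toℕ x + R) % n ≡ (toℕ y + R) % n
    shifts-equal = trans (sym (toℕ-shift x)) (trans (cong toℕ e) (toℕ-shift y))

  -- The shift moves multiples of p out of the multiples of p, as p ∤ R.
  shift-leaves-p : ∀ u → p ∣ toℕ u → ¬ p ∣ toℕ (shift u)
  shift-leaves-p u p∣u p∣shift =
    p∤R (∣m+n∣m⇒∣n (∣n∣m%n⇒∣m p∣n (subst (p ∣_) (toℕ-shift u) p∣shift)) p∣u)

  shift-annihilated : ∀ (v u : Fin n) → n ∣ toℕ v * R → n ∣ toℕ v * toℕ u → n ∣ toℕ v * toℕ (shift u)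
  shift-annihilated v u n∣vR n∣vu = subst (λ t → n ∣ toℕ v * t) (sym (toℕ-shift u))
    (∣*-mod (toℕ v) (toℕ u + R) n
      (subst (n ∣_) (sym (*-distribˡ-+ (toℕ v) (toℕ u) R)) (∣m∣n⇒∣m+n n∣vu n∣vR)))

  -- For p ∣ v the shift maps neighbours of v in V∖S injectively to
  -- neighbours in S, and misses the image of 0.
  complement-very-cost-effective : VeryCostEffectiveSet n label false
  complement-very-cost-effective v (v-vertex , v∉S) =
    very-cost-effective false v λ same other →
      card-< same other shift shift-injective
        (λ u ((_ , _ , _ , n∣vu) , (_ , u∉S)) → shifted-neighbour u (label-false u u∉S) n∣vu)
        (shift zero′) (shifted-neighbour zero′ p∣zero′ n∣v*zero′) misses
    where
    p∣v : p ∣ toℕ v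
    p∣v = label-false v v∉S
    zero′ : Fin n
    zero′ = fromℕ< (>-nonZero⁻¹ n)
    zero′-is-zero : IsZero zero′
    zero′-is-zero = toℕ-fromℕ< (>-nonZero⁻¹ n)
    p∣zero′ : p ∣ toℕ zero′
    p∣zero′ = subst (p ∣_) (sym zero′-is-zero) (p ∣0)
    n∣v*zero′ : n ∣ toℕ v * toℕ zero′
    n∣v*zero′ = subst (λ t → n ∣ toℕ v * t) (sym zero′-is-zero) (subst (n ∣_) (sym (*-zeroʳ (toℕ v))) (n ∣0))
    shifted-neighbour : ∀ u → p ∣ toℕ u → n ∣ toℕ v * toℕ u → OtherSide false v (shift u)
    shifted-neighbour u p∣u n∣vu =
      (v-vertex , annihilator-vertex v-vertex shift≢0 n∣v*shift , v≢shift , n∣v*shift)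
      , λ shift∉S → p∤shift (label-false _ (proj₂ shift∉S))
      where
      p∤shift : ¬ p ∣ toℕ (shift u)
      p∤shift = shift-leaves-p u p∣u
      n∣v*shift : n ∣ toℕ v * toℕ (shift u)
      n∣v*shift = shift-annihilated v u (*-monoˡ-∣ R p∣v) n∣vu
      shift≢0 : ¬ IsZero (shift u)
      shift≢0 shift≡0 = p∤shift (subst (p ∣_) (sym shift≡0) (p ∣0))
      v≢shift : v ≢ shift u
      v≢shift v≡shift = p∤shift (subst (λ t → p ∣ toℕ t) v≡shift p∣v)
    -- neighbours are vertices, hence nonzero, so their shifts differ from shift 0
    misses : ∀ x → SameSide false v x → shift x ≢ shift zero′
    misses x ((_ , ((x≢0 , _) , _) , _) , _) e = x≢0 (trans (cong toℕ (shift-injective e)) zero′-is-zero)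

  very-cost-effective-graph : VeryCostEffectiveGraph n
  very-cost-effective-graph = label , S-very-cost-effective , complement-very-cost-effective

mainTheorem7 : (n : ℕ) (ps : List ℕ) → 1 ≤ length ps → All Prime ps → Unique ps →
    n ≡ product ps → VeryCostEffectiveGraph n
mainTheorem7 n []       () _ _ _
mainTheorem7 n (p ∷ qs) _  all-prime@(p-prime ∷ qs-prime) distinct@(p∉qs ∷ _) refl =
  Bipartition.very-cost-effective-graph p (product qs) p-prime
    (prime∤product qs p-prime qs-prime p∉qs)
    (product-squarefree (p ∷ qs) all-prime distinct)
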